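{- Let $T$ be the canonical representation of a transmission irregular tree. Then for every $v \in V(T)$, the rooted subtree $T_v$ is weakly transmission irregular.
   Context: For a connected graph $G$ and $w \in V(G)$, the transmission is $\mathrm{Tr}_G(w) = \sum_{x \in V(G)} d_G(w,x)$, where $d_G$ is the shortest-path distance. A connected graph is transmission irregular (TI) if any two distinct vertices have different transmissions. An ordered rooted tree is a tree with a designated root and a total order on the children of each vertex; for a vertex $v$, $T_v$ is the rooted subtree consisting of $v$ and all its descendants, rooted at $v$, and $|T_v|$ its number of vertices. The level of a vertex in a rooted tree is its distance to the root. An ordered rooted tree $T$ is unbalanced if for every vertex $v$ with children $u_1, \dots, u_k$ (in order) we have $|T_{u_1}| < |T_{u_2}| < \cdots < |T_{u_k}|$. An ordered rooted tree $S$ is weakly transmission irregular (WTI) if any two distinct vertices of $S$ on the same level have different transmissions $\mathrm{Tr}_S$. For a TI tree, the components of $T - w$ have pairwise distinct orders for every vertex $w$; its canonical representation is the unique unbalanced ordered rooted tree obtained by rooting it at its (unique) vertex of minimum transmission and ordering children by increasing subtree order. -}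

module Defs where

open import Data.Nat using (ℕ; zero; suc; _+_; _*_; _∸_; _≤_; _<_)
open import Data.Nat.Properties using (_≟_)
open import Data.List using (List; []; _∷_; map; _++_; length)
open import Data.Nat.ListAction using (sum)
open import Data.List.Membership.Propositional using (_∈_)
open import Data.List.Relation.Unary.All using (All)
open import Data.List.Relation.Unary.Linked using (Linked)
open import Data.Maybe using (Maybe; just; nothing)
open import Data.Product using (_×_)
open import Relation.Binary.PropositionalEquality using (_≡_)
open import Relation.Nullary using (yes; no)

data Tree : Set where
  node : List Tree → Tree

mutual
  size : Tree → ℕ
  size (node ts) = suc (sizes ts)

  sizes : List Tree → ℕ
  sizes []       = 0
  sizes (t ∷ ts) = size t + sizes ts

sizeList : List Tree → List ℕ
sizeList []       = []
sizeList (t ∷ ts) = size t ∷ sizeList ts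

-- A vertex is addressed by its path from the root: the list of child
-- indices (0-based, in the given order) followed from the root.
mutual
  positions : Tree → List (List ℕ)
  positions (node ts) = [] ∷ positionsFrom 0 ts

  positionsFrom : ℕ → List Tree → List (List ℕ)
  positionsFrom i []       = []
  positionsFrom i (t ∷ ts) = map (i ∷_) (positions t) ++ positionsFrom (suc i) ts

-- length of the longest common prefix of two paths (= level of the
-- lowest common ancestor)
lcp : List ℕ → List ℕ → ℕ
lcp (a ∷ p) (b ∷ q) with a ≟ b
... | yes _ = suc (lcp p q)
... | no  _ = 0
lcp _ _ = 0

dist : List ℕ → List ℕ → ℕ
dist p q = (length p + length q) ∸ (2 * lcp p q)

level : List ℕ → ℕ
level = length

Tr : Tree → List ℕ → ℕ
Tr t w = sum (map (dist w) (positions t))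

mutual
  sub : Tree → List ℕ → Maybe Tree
  sub t []              = just t
  sub (node ts) (i ∷ p) = subFrom ts i p

  subFrom : List Tree → ℕ → List ℕ → Maybe Tree
  subFrom []       i       p = nothing
  subFrom (t ∷ ts) zero    p = sub t p
  subFrom (t ∷ ts) (suc i) p = subFrom ts i p

TI : Tree → Set
TI t = ∀ {v w} → v ∈ positions t → w ∈ positions t → Tr t v ≡ Tr t w → v ≡ w

WTI : Tree → Set
WTI t = ∀ {v w} → v ∈ positions t → w ∈ positions t →
        level v ≡ level w → Tr t v ≡ Tr t w → v ≡ w

data Unbalanced : Tree → Set where
  unb : ∀ {ts} → All Unbalanced ts → Linked _<_ (sizeList ts) → Unbalanced (node ts)

RootMinTr : Tree → Set
RootMinTr t = ∀ {w} → w ∈ positions t → Tr t [] ≤ Tr t w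

-- T is the canonical representation of a TI tree: T is TI, rooted at its
-- (unique, by TI) vertex of minimum transmission, children ordered by
-- increasing subtree order.
CanonicalTI : Tree → Set
CanonicalTI t = TI t × RootMinTr t × Unbalanced t

-- Tr_T(v ++ p) and Tr_{T_v}(p) differ by an amount depending only on the
-- level of p: distances from v ++ p to vertices inside T_v are distances
-- inside T_v, and the distance to a vertex x outside T_v is
-- level(p) + d_T(v, x). Hence two vertices of T_v on the same level with
-- equal transmission in T_v have equal transmission in T, and transmission
-- irregularity of T forces them to coincide.
module Submission where

open import Defs
open import Data.List using (List; []; _∷_; map; _++_; length)
open import Data.List.Properties using (++-cancelˡ; length-++; map-++)
open import Data.List.Membership.Propositional using (_∈_)
open import Data.List.Membership.Propositional.Properties using (∈-map⁺; ∈-++⁺ˡ)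
open import Data.List.Relation.Unary.All using (All; []; _∷_; universal)
import Data.List.Relation.Unary.All.Properties as All
open import Data.List.Relation.Binary.Permutation.Propositional
  using (_↭_; ↭-refl; ↭-sym; ↭-trans; prep)
open import Data.List.Relation.Binary.Permutation.Propositional.Properties
  using (map⁺; ++⁺ˡ; shift; shifts; ∈-resp-↭)
open import Data.Nat using (ℕ; zero; suc; _+_; _<_)
open import Data.Nat.Properties
open import Data.Nat.ListAction using (sum)
open import Data.Nat.ListAction.Properties using (sum-++; sum-↭)
open import Data.Maybe using (just)
open import Data.Product using (∃; _×_; _,_)
open import Data.Unit using (⊤; tt)
open import Data.Empty using (⊥-elim)
open import Relation.Nullary using (yes; no)
open import Relation.Binary.PropositionalEquality
open ≡-Reasoning

lcp-∷-≢ : ∀ {a b} p q → a ≢ b → lcp (a ∷ p) (b ∷ q) ≡ 0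
lcp-∷-≢ {a} {b} p q a≢b with a ≟ b
... | yes a≡b = ⊥-elim (a≢b a≡b)
... | no  _   = refl

lcp-∷-≡ : ∀ a p q → lcp (a ∷ p) (a ∷ q) ≡ suc (lcp p q)
lcp-∷-≡ a p q with a ≟ a
... | yes _   = refl
... | no  a≢a = ⊥-elim (a≢a refl)

dist-∷-≡ : ∀ a p q → dist (a ∷ p) (a ∷ q) ≡ dist p q
dist-∷-≡ a p q
  rewrite lcp-∷-≡ a p q | +-suc (length p) (length q) | +-suc (lcp p q) (lcp p q + 0) = refl

OffBranch : ℕ → List ℕ → Set
OffBranch a []      = ⊤
OffBranch a (b ∷ _) = b ≢ a

dist-offBranch : ∀ a p w → OffBranch a w → dist (a ∷ p) w ≡ suc (length p + length w)
dist-offBranch a p []      _   = refl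
dist-offBranch a p (b ∷ q) b≢a rewrite lcp-∷-≢ p q (λ a≡b → b≢a (sym a≡b)) = refl

sum-dist-inBranch : ∀ a p P →
  sum (map (dist (a ∷ p)) (map (a ∷_) P)) ≡ sum (map (dist p) P)
sum-dist-inBranch a p []      = refl
sum-dist-inBranch a p (q ∷ P) = cong₂ _+_ (dist-∷-≡ a p q) (sum-dist-inBranch a p P)

sum-dist-offBranch : ∀ a p R → All (OffBranch a) R →
  sum (map (dist (a ∷ p)) R) ≡ sum (map (λ w → suc (length p + length w)) R)
sum-dist-offBranch a p []      []         = refl
sum-dist-offBranch a p (w ∷ R) (off ∷ offs) =
  cong₂ _+_ (dist-offBranch a p w off) (sum-dist-offBranch a p R offs)

positionsFrom-offBranch : ∀ {a} k ts → a < k → All (OffBranch a) (positionsFrom k ts)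
positionsFrom-offBranch k []       a<k = []
positionsFrom-offBranch k (t ∷ ts) a<k =
  All.++⁺ (All.map⁺ (universal (λ _ k≡a → <-irrefl (sym k≡a) a<k) (positions t)))
          (positionsFrom-offBranch (suc k) ts (m<n⇒m<1+n a<k))

positionsFrom-branch : ∀ k ts i {c} → subFrom ts i [] ≡ just c →
  ∃ λ R → positionsFrom k ts ↭ map ((i + k) ∷_) (positions c) ++ R × All (OffBranch (i + k)) R
positionsFrom-branch k []       i       ()
positionsFrom-branch k (t ∷ ts) zero    refl =
  positionsFrom (suc k) ts , ↭-refl , positionsFrom-offBranch (suc k) ts (n<1+n k)
positionsFrom-branch k (t ∷ ts) (suc i) {c} eq with positionsFrom-branch (suc k) ts i eq
... | R , σ , offs rewrite +-suc i k =
  map (k ∷_) (positions t) ++ R ,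
  ↭-trans (++⁺ˡ (map (k ∷_) (positions t)) σ)
          (shifts (map (k ∷_) (positions t)) (map (suc (i + k) ∷_) (positions c))) ,
  All.++⁺ (All.map⁺ (universal (λ _ → m≢1+n+m k) (positions t))) offs

positions-branch : ∀ ts i {c} → subFrom ts i [] ≡ just c →
  ∃ λ R → positions (node ts) ↭ map (i ∷_) (positions c) ++ R × All (OffBranch i) R
positions-branch ts i {c} eq with positionsFrom-branch 0 ts i eq
... | R , σ , offs rewrite +-identityʳ i =
  [] ∷ R , ↭-trans (prep [] σ) (↭-sym (shift [] (map (i ∷_) (positions c)) R)) , tt ∷ offs

subFrom-∷ : ∀ ts i v {S} → subFrom ts i v ≡ just S →
  ∃ λ c → subFrom ts i [] ≡ just c × sub c v ≡ just S
subFrom-∷ []       i       v ()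
subFrom-∷ (t ∷ ts) zero    v eq = t , refl , eq
subFrom-∷ (t ∷ ts) (suc i) v eq = subFrom-∷ ts i v eq

∈-positions-sub : ∀ T v {S p} → sub T v ≡ just S → p ∈ positions S → v ++ p ∈ positions T
∈-positions-sub T         []      refl p∈S = p∈S
∈-positions-sub (node ts) (i ∷ v) eq   p∈S with subFrom-∷ ts i v eq
... | c , child , rest with positions-branch ts i child
... | R , σ , _ = ∈-resp-↭ (↭-sym σ) (∈-++⁺ˡ (∈-map⁺ (i ∷_) (∈-positions-sub c v rest p∈S)))

DiffersByLevel : (List ℕ → ℕ) → (List ℕ → ℕ) → Set
DiffersByLevel f h = ∃ λ (g : ℕ → ℕ) → ∀ p → f p ≡ h p + g (length p)

Tr-child : ∀ ts i {c} → subFrom ts i [] ≡ just c →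
  DiffersByLevel (λ q → Tr (node ts) (i ∷ q)) (Tr c)
Tr-child ts i {c} eq with positions-branch ts i eq
... | R , σ , offs = (λ n → sum (map (λ w → suc (n + length w)) R)) , λ q → begin
  Tr (node ts) (i ∷ q)
    ≡⟨ sum-↭ (map⁺ (dist (i ∷ q)) σ) ⟩
  sum (map (dist (i ∷ q)) (map (i ∷_) (positions c) ++ R))
    ≡⟨ cong sum (map-++ (dist (i ∷ q)) (map (i ∷_) (positions c)) R) ⟩
  sum (map (dist (i ∷ q)) (map (i ∷_) (positions c)) ++ map (dist (i ∷ q)) R)
    ≡⟨ sum-++ (map (dist (i ∷ q)) (map (i ∷_) (positions c))) _ ⟩
  sum (map (dist (i ∷ q)) (map (i ∷_) (positions c))) + sum (map (dist (i ∷ q)) R)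
    ≡⟨ cong₂ _+_ (sum-dist-inBranch i q (positions c)) (sum-dist-offBranch i q R offs) ⟩
  Tr c q + sum (map (λ w → suc (length q + length w)) R) ∎

Tr-sub : ∀ T v {S} → sub T v ≡ just S → DiffersByLevel (λ p → Tr T (v ++ p)) (Tr S)
Tr-sub T         []      refl = (λ _ → 0) , λ p → sym (+-identityʳ (Tr T p))
Tr-sub (node ts) (i ∷ v) {S} eq with subFrom-∷ ts i v eq
... | c , child , rest with Tr-child ts i child | Tr-sub c v rest
... | g₁ , h₁ | g₂ , h₂ = (λ n → g₂ n + g₁ (length v + n)) , λ p → begin
  Tr (node ts) (i ∷ v ++ p)                            ≡⟨ h₁ (v ++ p) ⟩
  Tr c (v ++ p) + g₁ (length (v ++ p))                 ≡⟨ cong₂ _+_ (h₂ p) (cong g₁ (length-++ v)) ⟩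
  Tr S p + g₂ (length p) + g₁ (length v + length p)    ≡⟨ +-assoc (Tr S p) _ _ ⟩
  Tr S p + (g₂ (length p) + g₁ (length v + length p))  ∎

Tr-sub-cong : ∀ T v {S p q} → sub T v ≡ just S → level p ≡ level q → Tr S p ≡ Tr S q →
  Tr T (v ++ p) ≡ Tr T (v ++ q)
Tr-sub-cong T v {S} {p} {q} eq level≡ TrSp≡TrSq with Tr-sub T v eq
... | g , h = begin
  Tr T (v ++ p)          ≡⟨ h p ⟩
  Tr S p + g (length p)  ≡⟨ cong₂ _+_ TrSp≡TrSq (cong g level≡) ⟩
  Tr S q + g (length q)  ≡⟨ h q ⟨
  Tr T (v ++ q)          ∎

corollary6 : (T : Tree) → CanonicalTI T →
    (v : List ℕ) (S : Tree) → sub T v ≡ just S → WTI S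
corollary6 T (TI-T , _ , _) v S eq {p} {q} p∈S q∈S level≡ TrSp≡TrSq =
  ++-cancelˡ v p q (TI-T (∈-positions-sub T v eq p∈S) (∈-positions-sub T v eq q∈S)
                         (Tr-sub-cong T v eq level≡ TrSp≡TrSq))
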